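{- Let $NC$ be an initial neuronal circuit, $N\in ln_{NC}$, and $\mathit{inp}$ a list of external input functions. If $w_N(id)\ge 0$ for every $id<|ln_{NC}|+si_{NC}$, then $curpot_{NC}(N,\mathit{inp})\ge 0$.
   Context: Booleans are identified with $0$ (false) and $1$ (true). A neuron $N$ consists of an identifier $id_N\in\mathbb{N}$, a weight function $w_N:\mathbb{N}\to\mathbb{Q}$ with $-1\le w_N(x)\le 1$ for all $x$ and $w_N(id_N)=0$, a leak factor $lk_N\in\mathbb{Q}$ with $0\le lk_N\le 1$, a threshold $\tau_N\in\mathbb{Q}$ with $\tau_N>0$, an output list $Output(N)$ of booleans (most recent first) and a current potential $CurPot(N)\in\mathbb{Q}$, subject to: $(\tau_N\le CurPot(N))$ equals the head of $Output(N)$ (the head of an empty list being $0$). An input function is a map $i:\mathbb{N}\to\{0,1\}$; $potential(w,i,len)=\sum_{0\le k<len,\ i(k)=1} w(k)$. The one-step update of $N$ with input function $i$ in an environment of $len$ neurons keeps $id,w,lk,\tau$, sets the new potential $p=potential(w_N,i,len)$ if $\tau_N\le CurPot(N)$ and $p=potential(w_N,i,len)+lk_N\cdot CurPot(N)$ otherwise, and sets the new output list to $(\tau_N\le p)::Output(N)$. A neuron is initial if its output list is $[0]$ and its current potential is $0$. A neuronal circuit $NC$ consists of a time $t_{NC}$, a list $ln_{NC}$ of neurons with pairwise distinct identifiers all $<|ln_{NC}|$ and all output lists of length $t_{NC}+1$, and a number $si_{NC}$ of external sources, with identifiers $|ln_{NC}|,\dots,L-1$, $L=|ln_{NC}|+si_{NC}$.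 One step of $NC$ on an external input function $e$ replaces each neuron $N$ by its one-step update in an environment of $L$ neurons with input function $x\mapsto$ (head of the output list, before the step, of the circuit neuron with identifier $x$ if $x<|ln_{NC}|$; $e(x)$ otherwise), and increments the time. A list of external input functions (most recent first) is processed from its last element to its first. For $N\in ln_{NC}$, $curpot_{NC}(N,\mathit{inp})$ is the current potential of the neuron with identifier $id_N$ after processing $\mathit{inp}$. $NC$ is initial if all its neurons are initial. -}

module Defs where

open import Data.Bool using (Bool; true; false; if_then_else_)
open import Data.Nat as ℕ using (ℕ; zero; suc; _<ᵇ_; _≡ᵇ_)
open import Data.Rational using (ℚ; 0ℚ; 1ℚ; _+_; _*_; _≤_; _<_; _≤ᵇ_; -_)
open import Data.List using (List; []; _∷_; map; length; foldr)
open import Data.List.Relation.Unary.All using (All)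
open import Data.List.Relation.Unary.Unique.Propositional using (Unique)
open import Data.Maybe using (Maybe; just; nothing)
open import Relation.Binary.PropositionalEquality using (_≡_)
open import Data.Product using (_×_)

-- Booleans: 0 = false, 1 = true.

headB : List Bool → Bool
headB []      = false
headB (b ∷ _) = b

record Neuron : Set where
  field
    id      : ℕ
    w       : ℕ → ℚ
    lk      : ℚ
    τ       : ℚ
    Output  : List Bool
    CurPot  : ℚ
    w-lo    : ∀ x → - 1ℚ ≤ w x
    w-hi    : ∀ x → w x ≤ 1ℚ
    w-self  : w id ≡ 0ℚ
    lk-lo   : 0ℚ ≤ lk
    lk-hi   : lk ≤ 1ℚ
    τ-pos   : 0ℚ < τ
    consistent : (τ ≤ᵇ CurPot) ≡ headB Output

open Neuron public

potential : (ℕ → ℚ) → (ℕ → Bool) → ℕ → ℚ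
potential w i zero    = 0ℚ
potential w i (suc k) = potential w i k + (if i k then w k else 0ℚ)

newPot : Neuron → (ℕ → Bool) → ℕ → ℚ
newPot N i len =
  if τ N ≤ᵇ CurPot N
  then potential (w N) i len
  else potential (w N) i len + lk N * CurPot N

update : Neuron → (ℕ → Bool) → ℕ → Neuron
update N i len = record
  { id = id N ; w = w N ; lk = lk N ; τ = τ N
  ; Output = (τ N ≤ᵇ newPot N i len) ∷ Output N
  ; CurPot = newPot N i len
  ; w-lo = w-lo N ; w-hi = w-hi N ; w-self = w-self N
  ; lk-lo = lk-lo N ; lk-hi = lk-hi N ; τ-pos = τ-pos N
  ; consistent = _≡_.refl }

Initial : Neuron → Set
Initial N = (Output N ≡ false ∷ []) × (CurPot N ≡ 0ℚ)

record Circuit : Set where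
  field
    time : ℕ
    ln   : List Neuron
    si   : ℕ

open Circuit public

WellFormed : Circuit → Set
WellFormed NC =
  Unique (map id (ln NC))
  × All (λ N → id N ℕ.< length (ln NC)) (ln NC)
  × All (λ N → length (Output N) ≡ suc (time NC)) (ln NC)

InitialCircuit : Circuit → Set
InitialCircuit NC = All Initial (ln NC)

findNeuron : ℕ → List Neuron → Maybe Neuron
findNeuron x []       = nothing
findNeuron x (N ∷ ns) = if id N ≡ᵇ x then just N else findNeuron x ns

headOf : Maybe Neuron → Bool
headOf nothing  = false
headOf (just N) = headB (Output N)

circuitInput : List Neuron → (ℕ → Bool) → ℕ → Bool
circuitInput ns e x = if x <ᵇ length ns then headOf (findNeuron x ns) else e x

step : Circuit → (ℕ → Bool) → Circuit
step NC e = record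
  { time = suc (time NC)
  ; ln   = map (λ N → update N (circuitInput (ln NC) e)
                               (length (ln NC) ℕ.+ si NC)) (ln NC)
  ; si   = si NC }

-- a list of external inputs (most recent first) is processed last to first
run : Circuit → List (ℕ → Bool) → Circuit
run NC []       = NC
run NC (e ∷ es) = step (run NC es) e

curpot : Circuit → Neuron → List (ℕ → Bool) → Maybe ℚ
curpot NC N inp with findNeuron (id N) (ln (run NC inp))
... | nothing = nothing
... | just M  = just (CurPot M)

{-# OPTIONS --safe #-}
module Submission where

-- Along a run, the neuron carrying N's identifier keeps N's weights, and one update keeps its
-- potential non-negative: the new potential is a sum of weights (all ≥ 0 on the environment),
-- possibly plus the leak factor (≥ 0) times the old, non-negative, potential.

open import Defs
open import Data.Bool using (Bool; true; false; if_then_else_)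
open import Data.Bool.Properties using (T-≡)
open import Data.Empty using (⊥-elim)
open import Data.List using (List; []; _∷_; length; map)
open import Data.List.Membership.Propositional using (_∈_)
open import Data.List.Membership.Propositional.Properties using (∈-map⁺)
open import Data.List.Properties using (length-map)
open import Data.List.Relation.Unary.All using (lookup)
open import Data.List.Relation.Unary.AllPairs using (_∷_)
open import Data.List.Relation.Unary.Any using (here; there)
open import Data.List.Relation.Unary.Unique.Propositional using (Unique)
open import Data.Maybe as Maybe using (just)
open import Data.Nat using (ℕ; zero; suc; _+_; _<_; _≡ᵇ_)
open import Data.Nat.Properties using (≤-refl; m<n⇒m<1+n; ≡ᵇ⇒≡; ≡⇒≡ᵇ)
open import Data.Product using (Σ; _×_; _,_; proj₂)
open import Data.Rational as ℚ using (ℚ; 0ℚ; _≤_; _≤ᵇ_)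
import Data.Rational.Properties as ℚ
open import Function using (Equivalence)
open import Relation.Binary.PropositionalEquality using (_≡_; refl; sym; cong; trans; subst)

private
  variable
    p q : ℚ

0≤+ : 0ℚ ≤ p → 0ℚ ≤ q → 0ℚ ≤ p ℚ.+ q
0≤+ = ℚ.+-mono-≤

0≤* : 0ℚ ≤ p → 0ℚ ≤ q → 0ℚ ≤ p ℚ.* q
0≤* {p} {q} 0≤p 0≤q = ℚ.nonNegative⁻¹ (p ℚ.* q)
  {{ℚ.nonNeg*nonNeg⇒nonNeg p {{ℚ.nonNegative 0≤p}} q {{ℚ.nonNegative 0≤q}}}}

NonNegBelow : ℕ → (ℕ → ℚ) → Set
NonNegBelow len w = ∀ x → x < len → 0ℚ ≤ w x

potential-nonNeg : ∀ {w} i len → NonNegBelow len w → 0ℚ ≤ potential w i len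
potential-nonNeg     i zero    w≥0 = ℚ.≤-refl
potential-nonNeg {w} i (suc k) w≥0 =
  0≤+ (potential-nonNeg i k (λ x x<k → w≥0 x (m<n⇒m<1+n x<k))) last-term-nonNeg
  where
  last-term-nonNeg : 0ℚ ≤ (if i k then w k else 0ℚ)
  last-term-nonNeg with i k
  ... | true  = w≥0 k ≤-refl
  ... | false = ℚ.≤-refl

newPot-nonNeg : ∀ N i len → NonNegBelow len (w N) → 0ℚ ≤ CurPot N → 0ℚ ≤ newPot N i len
newPot-nonNeg N i len w≥0 pot≥0 with τ N ≤ᵇ CurPot N
... | true  = potential-nonNeg i len w≥0
... | false = 0≤+ (potential-nonNeg i len w≥0) (0≤* (lk-lo N) pot≥0)

findNeuron-map : ∀ {x M} (f : Neuron → Neuron) → (∀ K → id (f K) ≡ id K) → ∀ ns →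
                 findNeuron x ns ≡ just M → findNeuron x (map f ns) ≡ just (f M)
findNeuron-map {x} f f-id (K ∷ ks) found rewrite f-id K with id K ≡ᵇ x
... | true  = cong (Maybe.map f) found
... | false = findNeuron-map f f-id ks found

findNeuron-∈ : ∀ {N ns} → Unique (map id ns) → N ∈ ns → findNeuron (id N) ns ≡ just N
findNeuron-∈ {ns = K ∷ _} _ (here refl)
  rewrite Equivalence.to T-≡ (≡⇒≡ᵇ (id K) (id K) refl) = refl
findNeuron-∈ {N} {K ∷ _} (K∉ks ∷ uniq) (there N∈ks) with id K ≡ᵇ id N in eq
... | true  = ⊥-elim (lookup K∉ks (∈-map⁺ id N∈ks) (≡ᵇ⇒≡ (id K) (id N) (Equivalence.from T-≡ eq)))
... | false = findNeuron-∈ uniq N∈ks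

envSize : Circuit → ℕ
envSize C = length (ln C) + si C

envSize-run : ∀ C es → envSize (run C es) ≡ envSize C
envSize-run C []       = refl
envSize-run C (e ∷ es) =
  trans (cong (_+ si (run C es)) (length-map _ (ln (run C es)))) (envSize-run C es)

record NonNegCopy (N : Neuron) (C : Circuit) : Set where
  field
    neuron     : Neuron
    found      : findNeuron (id N) (ln C) ≡ just neuron
    same-w     : w neuron ≡ w N
    nonNeg-pot : 0ℚ ≤ CurPot neuron

initial-nonNegCopy : ∀ {C N} → WellFormed C → InitialCircuit C → N ∈ ln C → NonNegCopy N C
initial-nonNegCopy {N = N} (uniq , _) ini N∈ = record
  { neuron     = N
  ; found      = findNeuron-∈ uniq N∈
  ; same-w     = refl
  ; nonNeg-pot = ℚ.≤-reflexive (sym (proj₂ (lookup ini N∈)))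
  }

step-nonNegCopy : ∀ {N C} e → NonNegBelow (envSize C) (w N) → NonNegCopy N C →
                  NonNegCopy N (step C e)
step-nonNegCopy {N} {C} e w≥0 copy = record
  { neuron     = update M i (envSize C)
  ; found      = findNeuron-map (λ K → update K i (envSize C)) (λ _ → refl) (ln C) found
  ; same-w     = same-w
  ; nonNeg-pot = newPot-nonNeg M i (envSize C) (subst (NonNegBelow _) (sym same-w) w≥0) nonNeg-pot
  }
  where
  open NonNegCopy copy renaming (neuron to M)
  i : ℕ → Bool
  i = circuitInput (ln C) e

run-nonNegCopy : ∀ {N} C → NonNegBelow (envSize C) (w N) → NonNegCopy N C →
                 ∀ es → NonNegCopy N (run C es)
run-nonNegCopy     C w≥0 copy []       = copy
run-nonNegCopy {N} C w≥0 copy (e ∷ es) =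
  step-nonNegCopy e (subst (λ L → NonNegBelow L (w N)) (sym (envSize-run C es)) w≥0)
                    (run-nonNegCopy C w≥0 copy es)

curpot-found : ∀ C N inp {M} → findNeuron (id N) (ln (run C inp)) ≡ just M →
               curpot C N inp ≡ just (CurPot M)
curpot-found C N inp found rewrite found = refl

corollary5p1 : (NC : Circuit) → WellFormed NC → InitialCircuit NC →
    (N : Neuron) → N ∈ ln NC → (inp : List (ℕ → Bool)) →
    (∀ x → x < length (ln NC) + si NC → 0ℚ ≤ w N x) →
    Σ ℚ (λ q → (curpot NC N inp ≡ just q) × (0ℚ ≤ q))
corollary5p1 NC wf ini N N∈ inp w≥0 = CurPot M , curpot-found NC N inp found , nonNeg-pot
  where
  copy : NonNegCopy N (run NC inp)
  copy = run-nonNegCopy NC w≥0 (initial-nonNegCopy wf ini N∈) inp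
  open NonNegCopy copy renaming (neuron to M)
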